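{- Let $A,B$ be simple graphs on vertex set $\{1,\dots,n\}$ (square-free monomials in the $a_{ij}$). For $g\in[\mathrm{Stab}(A):S_n:\mathrm{Stab}(B)]$ let $\phi(g)$ be the isomorphism class of the edge-colored graph on $\{1,\dots,n\}$ whose edges are those of $A$ and of $g(B)$, where an edge has color $1$ if it lies only in $A$, color $2$ if it lies only in $g(B)$, and color $3$ if it lies in both. Let $\mathcal{C}(A,B)$ be the set of isomorphism classes of the colored graphs obtained in the same way from $A$ and $\rho(B)$ for all $\rho\in S_n$. Then $\phi$ is a bijection from $[\mathrm{Stab}(A):S_n:\mathrm{Stab}(B)]$ onto $\mathcal{C}(A,B)$.
   Context: $S_n$ acts on graphs on $\{1,\dots,n\}$ by permuting vertices ($\rho(a_{ij})=a_{\rho(i)\rho(j)}$); $\mathrm{Stab}(A)=\{\rho\in S_n:\rho(A)=A\}$. For subgroups $H,K\le S_n$, $[H:S_n:K]$ is a set of representatives of the double cosets $HgK$. Two edge-colored graphs on $\{1,\dots,n\}$ are isomorphic if some permutation of the vertices maps one onto the other preserving edge colors. -}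

module Defs where

open import Data.Nat using (ℕ)
open import Data.Fin using (Fin)
open import Data.Bool using (Bool; true; false; _∧_)
open import Data.Product using (Σ; ∃; _×_; _,_)
open import Data.Maybe using (Maybe; just; nothing)
open import Data.Fin.Permutation public using (Permutation′; _⟨$⟩ʳ_; _⟨$⟩ˡ_)
open import Relation.Binary.PropositionalEquality using (_≡_)
open import Relation.Nullary using (¬_)

-- A simple graph on vertex set Fin n ({1,…,n}): a symmetric, irreflexive
-- Boolean adjacency (a square-free monomial in the variables a_ij, i<j).
record SimpleGraph (n : ℕ) : Set where
  field
    adj   : Fin n → Fin n → Bool
    sym   : ∀ i j → adj i j ≡ adj j i
    irrefl : ∀ i → adj i i ≡ false
open SimpleGraph public

-- Action of ρ ∈ S_n: ρ(a_ij) = a_{ρ(i)ρ(j)}, so (ρ A) has edge {ρ i, ρ j}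
-- iff A has edge {i, j}; i.e. (ρ A)(k,l) = A(ρ⁻¹ k, ρ⁻¹ l).
act : ∀ {n} → Permutation′ n → (Fin n → Fin n → Bool) → (Fin n → Fin n → Bool)
act ρ A k l = A (ρ ⟨$⟩ˡ k) (ρ ⟨$⟩ˡ l)

_≈ₚ_ : ∀ {n} → Permutation′ n → Permutation′ n → Set
ρ ≈ₚ σ = ∀ x → ρ ⟨$⟩ʳ x ≡ σ ⟨$⟩ʳ x

Stab : ∀ {n} → SimpleGraph n → Permutation′ n → Set
Stab A σ = ∀ k l → act σ (adj A) k l ≡ adj A k l

InDoubleCoset : ∀ {n} → SimpleGraph n → SimpleGraph n →
                Permutation′ n → Permutation′ n → Set
InDoubleCoset {n} A B g ρ =
  Σ (Permutation′ n) λ σ → Σ (Permutation′ n) λ τ →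
    Stab A σ × Stab B τ × (∀ x → ρ ⟨$⟩ʳ x ≡ σ ⟨$⟩ʳ (g ⟨$⟩ʳ (τ ⟨$⟩ʳ x)))

IsDoubleCosetReps : ∀ {n} → SimpleGraph n → SimpleGraph n →
                    (Permutation′ n → Set) → Set
IsDoubleCosetReps A B R =
  (∀ ρ → Σ _ λ g → R g × InDoubleCoset A B g ρ) ×
  (∀ g h → R g → R h → InDoubleCoset A B g h → g ≈ₚ h)

-- Edge colors 1,2,3; 'nothing' = no edge.
data Color : Set where
  c1 c2 c3 : Color

EdgeColoredGraph : ℕ → Set
EdgeColoredGraph n = Fin n → Fin n → Maybe Color

overlay : ∀ {n} → (Fin n → Fin n → Bool) → (Fin n → Fin n → Bool) → EdgeColoredGraph n
overlay A C i j with A i j | C i j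
... | true  | true  = just c3
... | true  | false = just c1
... | false | true  = just c2
... | false | false = nothing

colGraph : ∀ {n} → SimpleGraph n → SimpleGraph n → Permutation′ n → EdgeColoredGraph n
colGraph A B ρ = overlay (adj A) (act ρ (adj B))

_≅_ : ∀ {n} → EdgeColoredGraph n → EdgeColoredGraph n → Set
_≅_ {n} G H = Σ (Permutation′ n) λ π → ∀ i j → H (π ⟨$⟩ʳ i) (π ⟨$⟩ʳ j) ≡ G i j

-- The colour of an edge records its membership in each of the two graphs, so an
-- isomorphism π between the coloured graphs of g and h preserves A and carries
-- g(B) onto h(B): π ∈ Stab(A) and h⁻¹πg ∈ Stab(B), i.e. h ∈ Stab(A) g Stab(B).
-- Conversely, if ρ = σgτ with σ ∈ Stab(A), τ ∈ Stab(B), then σ⁻¹ is an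
-- isomorphism from the coloured graph of ρ to that of g. Hence the coloured
-- graphs of g and h are isomorphic exactly when g and h lie in the same double
-- coset, which is injectivity and surjectivity of φ on the representatives.
module Submission where

open import Defs hiding (sym)
open import Data.Nat using (ℕ)
open import Data.Product using (Σ; _×_; _,_; proj₁; proj₂)
open import Data.Bool using (Bool; true; false)
open import Data.Maybe using (Maybe; just; nothing)
open import Data.Fin using (Fin)
open import Data.Fin.Permutation using (flip; _∘ₚ_; inverseˡ; inverseʳ)
open import Relation.Binary.PropositionalEquality
open ≡-Reasoning

color : Bool → Bool → Maybe Color
color true  true  = just c3
color true  false = just c1
color false true  = just c2
color false false = nothing

inFirst : Maybe Color → Bool
inFirst (just c1) = true
inFirst (just c3) = true
inFirst _         = false

inSecond : Maybe Color → Bool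
inSecond (just c2) = true
inSecond (just c3) = true
inSecond _         = false

inFirst-color : ∀ a b → inFirst (color a b) ≡ a
inFirst-color true  true  = refl
inFirst-color true  false = refl
inFirst-color false true  = refl
inFirst-color false false = refl

inSecond-color : ∀ a b → inSecond (color a b) ≡ b
inSecond-color true  true  = refl
inSecond-color true  false = refl
inSecond-color false true  = refl
inSecond-color false false = refl

color-injective : ∀ {a b c d} → color a b ≡ color c d → a ≡ c × b ≡ d
color-injective {a} {b} {c} {d} e =
  trans (sym (inFirst-color a b)) (trans (cong inFirst e) (inFirst-color c d)) ,
  trans (sym (inSecond-color a b)) (trans (cong inSecond e) (inSecond-color c d))

overlay≡color : ∀ {n} (A C : Fin n → Fin n → Bool) i j →
                overlay A C i j ≡ color (A i j) (C i j)
overlay≡color A C i j with A i j | C i j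
... | true  | true  = refl
... | true  | false = refl
... | false | true  = refl
... | false | false = refl

module _ {n} (A C A′ C′ : Fin n → Fin n → Bool) {i j k l : Fin n} where

  overlay-injective : overlay A C i j ≡ overlay A′ C′ k l →
                      A i j ≡ A′ k l × C i j ≡ C′ k l
  overlay-injective e = color-injective (begin
    color (A i j) (C i j)     ≡⟨ sym (overlay≡color A C i j) ⟩
    overlay A C i j           ≡⟨ e ⟩
    overlay A′ C′ k l         ≡⟨ overlay≡color A′ C′ k l ⟩
    color (A′ k l) (C′ k l)   ∎)

  overlay-cong : A i j ≡ A′ k l → C i j ≡ C′ k l →
                 overlay A C i j ≡ overlay A′ C′ k l
  overlay-cong eA eC = begin
    overlay A C i j           ≡⟨ overlay≡color A C i j ⟩
    color (A i j) (C i j)     ≡⟨ cong₂ color eA eC ⟩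
    color (A′ k l) (C′ k l)   ≡⟨ sym (overlay≡color A′ C′ k l) ⟩
    overlay A′ C′ k l         ∎

flip-cong : ∀ {n} {ρ π : Permutation′ n} → ρ ≈ₚ π → flip ρ ≈ₚ flip π
flip-cong {ρ = ρ} {π} ρ≈π y = begin
  ρ ⟨$⟩ˡ y                        ≡⟨ cong (ρ ⟨$⟩ˡ_) (sym (inverseʳ π)) ⟩
  ρ ⟨$⟩ˡ (π ⟨$⟩ʳ (π ⟨$⟩ˡ y))      ≡⟨ cong (ρ ⟨$⟩ˡ_) (sym (ρ≈π (π ⟨$⟩ˡ y))) ⟩
  ρ ⟨$⟩ˡ (ρ ⟨$⟩ʳ (π ⟨$⟩ˡ y))      ≡⟨ inverseˡ ρ ⟩
  π ⟨$⟩ˡ y                        ∎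

preserves⇒Stab : ∀ {n} (A : SimpleGraph n) (π : Permutation′ n) →
                 (∀ i j → adj A (π ⟨$⟩ʳ i) (π ⟨$⟩ʳ j) ≡ adj A i j) → Stab A π
preserves⇒Stab A π preserves k l = begin
  adj A (π ⟨$⟩ˡ k) (π ⟨$⟩ˡ l)                         ≡⟨ sym (preserves _ _) ⟩
  adj A (π ⟨$⟩ʳ (π ⟨$⟩ˡ k)) (π ⟨$⟩ʳ (π ⟨$⟩ˡ l))       ≡⟨ cong₂ (adj A) (inverseʳ π) (inverseʳ π) ⟩
  adj A k l                                           ∎

module _ {n} (A B : SimpleGraph n) where

  colGraph-injective : ∀ g h {i j k l} → colGraph A B g i j ≡ colGraph A B h k l →
    adj A i j ≡ adj A k l × act g (adj B) i j ≡ act h (adj B) k l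
  colGraph-injective g h = overlay-injective (adj A) (act g (adj B)) (adj A) (act h (adj B))

  colGraph-cong : ∀ g h {i j k l} →
    adj A i j ≡ adj A k l → act g (adj B) i j ≡ act h (adj B) k l →
    colGraph A B g i j ≡ colGraph A B h k l
  colGraph-cong g h = overlay-cong (adj A) (act g (adj B)) (adj A) (act h (adj B))

  ≅⇒InDoubleCoset : ∀ g h → colGraph A B g ≅ colGraph A B h → InDoubleCoset A B g h
  ≅⇒InDoubleCoset g h (π , iso) = π , τ , π∈StabA , τ∈StabB , h≡πgτ
    where
    τ : Permutation′ n
    τ = h ∘ₚ flip π ∘ₚ flip g

    π∈StabA : Stab A π
    π∈StabA = preserves⇒Stab A π λ i j → proj₁ (colGraph-injective h g (iso i j))

    τ∈StabB : Stab B τ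
    τ∈StabB k l = begin
      adj B (h ⟨$⟩ˡ (π ⟨$⟩ʳ (g ⟨$⟩ʳ k))) (h ⟨$⟩ˡ (π ⟨$⟩ʳ (g ⟨$⟩ʳ l)))
        ≡⟨ proj₂ (colGraph-injective h g (iso (g ⟨$⟩ʳ k) (g ⟨$⟩ʳ l))) ⟩
      adj B (g ⟨$⟩ˡ (g ⟨$⟩ʳ k)) (g ⟨$⟩ˡ (g ⟨$⟩ʳ l))
        ≡⟨ cong₂ (adj B) (inverseˡ g) (inverseˡ g) ⟩
      adj B k l ∎

    h≡πgτ : ∀ x → h ⟨$⟩ʳ x ≡ π ⟨$⟩ʳ (g ⟨$⟩ʳ (τ ⟨$⟩ʳ x))
    h≡πgτ x = sym (trans (cong (π ⟨$⟩ʳ_) (inverseʳ g)) (inverseʳ π))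

  InDoubleCoset⇒≅ : ∀ g ρ → InDoubleCoset A B g ρ → colGraph A B ρ ≅ colGraph A B g
  InDoubleCoset⇒≅ g ρ (σ , τ , σ∈StabA , τ∈StabB , ρ≡σgτ) =
    flip σ , λ i j → colGraph-cong g ρ (σ∈StabA i j) (onB i j)
    where
    ρ⁻¹≡τ⁻¹g⁻¹σ⁻¹ : flip ρ ≈ₚ flip (τ ∘ₚ g ∘ₚ σ)
    ρ⁻¹≡τ⁻¹g⁻¹σ⁻¹ = flip-cong {ρ = ρ} {π = τ ∘ₚ g ∘ₚ σ} ρ≡σgτ

    onB : ∀ i j → act g (adj B) (σ ⟨$⟩ˡ i) (σ ⟨$⟩ˡ j) ≡ act ρ (adj B) i j
    onB i j = begin
      adj B (g ⟨$⟩ˡ (σ ⟨$⟩ˡ i)) (g ⟨$⟩ˡ (σ ⟨$⟩ˡ j))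
        ≡⟨ sym (τ∈StabB _ _) ⟩
      adj B (τ ⟨$⟩ˡ (g ⟨$⟩ˡ (σ ⟨$⟩ˡ i))) (τ ⟨$⟩ˡ (g ⟨$⟩ˡ (σ ⟨$⟩ˡ j)))
        ≡⟨ sym (cong₂ (adj B) (ρ⁻¹≡τ⁻¹g⁻¹σ⁻¹ i) (ρ⁻¹≡τ⁻¹g⁻¹σ⁻¹ j)) ⟩
      adj B (ρ ⟨$⟩ˡ i) (ρ ⟨$⟩ˡ j) ∎

proposition2 : ∀ (n : ℕ) (A B : SimpleGraph n) (R : Permutation′ n → Set) →
    IsDoubleCosetReps A B R →
    ((∀ g h → R g → R h → colGraph A B g ≅ colGraph A B h → g ≈ₚ h) ×
    (∀ ρ → Σ (Permutation′ n) λ g → R g × (colGraph A B ρ ≅ colGraph A B g)))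
proposition2 n A B R (covers , distinct) = injective , surjective
  where
  injective : ∀ g h → R g → R h → colGraph A B g ≅ colGraph A B h → g ≈ₚ h
  injective g h g∈R h∈R g≅h = distinct g h g∈R h∈R (≅⇒InDoubleCoset A B g h g≅h)

  surjective : ∀ ρ → Σ (Permutation′ n) λ g → R g × (colGraph A B ρ ≅ colGraph A B g)
  surjective ρ with covers ρ
  ... | g , g∈R , ρ∈HgK = g , g∈R , InDoubleCoset⇒≅ A B g ρ ρ∈HgK
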